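{- For any $1\le i<j\le n$, the operators $T_{ij}$ and $O$ on $QH^*(Fl_n,\mathbb{Z})$ commute: $T_{ij}\,O=O\,T_{ij}$.
   Context: $Fl_n$ is the complete flag manifold in $\mathbb{C}^n$; $QH^*(Fl_n,\mathbb{Z})\cong H^*(Fl_n,\mathbb{Z})\otimes\mathbb{Z}[q_1,\dots,q_{n-1}]$ is its small quantum cohomology ring, a free $\mathbb{Z}[q_1,\dots,q_{n-1}]$-module with basis the Schubert classes $\sigma_w$, $w\in S_n$. $\ell(w)$ is the number of inversions of $w$; $s_{ij}$ is the transposition of $i$ and $j$; products of permutations are compositions, so $ws_{ij}$ is $w$ with the values in positions $i,j$ swapped. For $i<j$, $q_{ij}=q_iq_{i+1}\cdots q_{j-1}$. The $\mathbb{Z}[q]$-linear operator $T_{ij}$ ($1\le i<j\le n$) is defined by $T_{ij}(\sigma_w)=\sigma_{ws_{ij}}$ if $\ell(ws_{ij})=\ell(w)+1$; $T_{ij}(\sigma_w)=q_{ij}\sigma_{ws_{ij}}$ if $\ell(ws_{ij})=\ell(w)-2(j-i)+1$; and $T_{ij}(\sigma_w)=0$ otherwise. Let $o\in S_n$ be the cycle $o(k)=k+1$ for $k<n$, $o(n)=1$. The twisted cyclic shift operator $O$ is the $\mathbb{Z}[q]$-linear operator with $O(\sigma_w)=q_{rn}\,\sigma_{ow}$, where $r=w^{ -1}(n)$ (and $q_{nn}=1$). -}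

module Defs where

-- Model of QH*(Fl_n, ℤ) at the level of the Schubert basis.
-- Conventions (0-based): positions and values of permutations are Fin n.
-- A permutation w is stored in one-line notation: lookup w k = w(k).
-- A monomial q_1^{a_1} ... q_n^{a_n} is stored as its exponent vector
-- (entry k, 0-based, = exponent of q_{k+1}); q_n never occurs.
-- A "term" is either 0 (nothing) or  q^e · σ_w  (just (e , w)).
-- Z[q]-linear operators defined on the Schubert basis send a basis element
-- to such a term; `ext` is their Z[q]-linear action on terms.

open import Data.Nat as ℕ using (ℕ; zero; suc; _+_; _*_; _∸_; _<ᵇ_; _≤ᵇ_; _≡ᵇ_)
open import Data.Fin as Fin using (Fin; toℕ; fromℕ; fromℕ<; zero; suc)
open import Data.Vec using (Vec; []; _∷_; lookup; tabulate; map; zipWith; replicate; sum; _[_]≔_)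
open import Data.Maybe using (Maybe; just; nothing)
open import Data.Product using (_×_; _,_)
open import Data.Bool using (Bool; if_then_else_; true; false; _∧_)
open import Relation.Nullary using (yes; no)
open import Data.Fin.Permutation using (Permutation′; _⟨$⟩ʳ_)

OneLine : ℕ → Set
OneLine n = Vec (Fin n) n

Mono : ℕ → Set
Mono n = Vec ℕ n

Term : ℕ → Set
Term n = Maybe (Mono n × OneLine n)

oneLine : ∀ {n} → Permutation′ n → OneLine n
oneLine π = tabulate (π ⟨$⟩ʳ_)

basis : ∀ {n} → Mono n → Permutation′ n → Term n
basis e π = just (e , oneLine π)

ext : ∀ {n} → (OneLine n → Term n) → Term n → Term n
ext f nothing = nothing
ext f (just (e , w)) with f w
... | nothing = nothing
... | just (e′ , v) = just (zipWith _+_ e e′ , v)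

inv : ∀ {n} → OneLine n → ℕ
inv w = sum (tabulate λ a → sum (tabulate λ b →
  if (toℕ a <ᵇ toℕ b) ∧ (toℕ (lookup w b) <ᵇ toℕ (lookup w a)) then 1 else 0))

-- w s_ij : swap the values in positions i and j
swap : ∀ {n} → OneLine n → Fin n → Fin n → OneLine n
swap w i j = (w [ i ]≔ lookup w j) [ j ]≔ lookup w i

-- exponent vector of q_a q_{a+1} ... q_{b-1}  (0-based: positions k with a ≤ k < b)
qInterval : ∀ {n} → ℕ → ℕ → Mono n
qInterval a b = tabulate λ k → if (a ≤ᵇ toℕ k) ∧ (toℕ k <ᵇ b) then 1 else 0

zeroMono : ∀ {n} → Mono n
zeroMono = replicate _ 0

-- T_ij on the Schubert basis (i < j, 0-based); q_{ij} = qInterval i j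
T : ∀ {n} → Fin n → Fin n → OneLine n → Term n
T i j w =
  if inv (swap w i j) ≡ᵇ inv w + 1
  then just (zeroMono , swap w i j)
  else (if inv (swap w i j) + 2 * (toℕ j ∸ toℕ i) ≡ᵇ inv w + 1
        then just (qInterval (toℕ i) (toℕ j) , swap w i j)
        else nothing)

-- the cycle o : k ↦ k+1 (k < n), n ↦ 1   (0-based on Fin (suc m))
cyc : ∀ {m} → Fin (suc m) → Fin (suc m)
cyc {m} k with toℕ k ℕ.<? m
... | yes p = suc (fromℕ< p)
... | no _ = zero

-- 0-based position of the value x in w (w⁻¹(x)); length of w if absent
posOf : ∀ {n k} → Fin n → Vec (Fin n) k → ℕ
posOf x [] = 0
posOf x (y ∷ ys) = if toℕ x ≡ᵇ toℕ y then 0 else suc (posOf x ys)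

-- O(σ_w) = q_{rn} σ_{ow},  r = w⁻¹(n)  (0-based: r' = posOf last w,
-- q_{rn} = q_r ⋯ q_{n-1} has exponents at 0-based positions r' .. m-1, n = suc m)
O : ∀ {m} → OneLine (suc m) → Term (suc m)
O {m} w = just (qInterval (posOf (fromℕ m) w) m , map cyc w)

module Submission where

-- The cyclic shift o sends the top value n to 1 and raises every other value by one, so it keeps
-- the relative order of the other values; if n sits at the (0-based) position t of w, then n loses
-- its n - 1 - t inversions with later entries and 1 gains t inversions with earlier ones:
-- ℓ(o w) + (n - 1) = ℓ(w) + 2t.  So O shifts lengths by an amount depending only on where n sits.
-- If n is at neither i nor j, it sits at the same place in w and w s_ij, the length jumps
-- ℓ(w s_ij) - ℓ(w) and ℓ(o w s_ij) - ℓ(o w) agree, both sides take the same case of T_ij, and the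
-- monomials commute.  If n is at i (resp. j), the transposition moves it to j (resp. i), so the two
-- jumps differ by 2(j - i) and have opposite signs: a quantum step on one side is a classical step
-- on the other, and the q_ij it carries is exactly q_in / q_jn, the ratio of the monomials attached
-- by O before and after transposing.

open import Defs
open import Data.Nat using (ℕ; suc)
open import Data.Fin using (Fin; _<_)
open import Data.Fin.Permutation using (Permutation′)
open import Relation.Binary.PropositionalEquality using (_≡_)

open import Data.Bool using (true; false; if_then_else_; _∧_)
open import Data.Fin as Fin using (zero; suc; toℕ; fromℕ)
import Data.Fin.Properties as Fin
open import Data.Fin.Permutation using (_⟨$⟩ʳ_; _⟨$⟩ˡ_; inverseʳ; inverseˡ; transpose; _∘ₚ_)
import Data.Fin.Permutation.Components as PC
open import Data.Maybe as Maybe using (Maybe; just; nothing)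
open import Data.Maybe.Relation.Binary.Pointwise as Pointwise using (Pointwise; just; nothing)
open import Data.Nat as ℕ using (zero; _+_; _*_; _∸_; _<ᵇ_; _≤ᵇ_; _≡ᵇ_; z≤n; s≤s)
open import Data.Nat.Properties as ℕ
  using (+-assoc; +-comm; +-suc; +-identityʳ; +-mono-≤; +-mono-≤-<; +-monoʳ-≤; +-monoʳ-<;
         ≤-refl; ≤-reflexive)
open import Data.Nat.Tactic.RingSolver using (solve-∀)
open import Algebra.Properties.CommutativeSemigroup ℕ.+-commutativeSemigroup
  using (x∙yz≈y∙xz; xy∙z≈zy∙x; xy∙z≈xz∙y; xy∙z≈zx∙y; interchange)
open import Data.Product using (_×_; _,_; proj₁; proj₂)
open import Data.Vec using (Vec; []; _∷_; lookup; tabulate; sum; map; zipWith; _[_]≔_)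
open import Data.Vec.Properties
  using ([]≔-lookup; map-[]≔; lookup-map; lookup∘update; lookup∘update′; lookup∘tabulate;
         tabulate∘lookup; tabulate-cong; zipWith-assoc; zipWith-comm; zipWith-identityˡ; zipWith-identityʳ)
open import Data.Vec.Relation.Unary.All using (All; []; _∷_)
open import Data.Vec.Relation.Unary.All.Properties using (lookup⁻)
open import Function using (_∘_)
open import Function.Bundles using (_⇔_; mk⇔)
open import Relation.Binary.PropositionalEquality
  using (_≢_; refl; sym; trans; cong; cong₂; subst; subst₂; module ≡-Reasoning)
open import Relation.Nullary using (¬_; Dec; yes; no; contradiction)
open import Relation.Nullary.Decidable using (dec-true; dec-false; does-⇔)

variable
  n k : ℕ

Pointwise-map : {A B : Set} {R S : A → B → Set} → (∀ {x y} → R x y → S x y) →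
  ∀ {mx my} → Pointwise R mx my → Pointwise S mx my
Pointwise-map f (just r) = just (f r)
Pointwise-map f nothing = nothing

map-cong-Pointwise : {A B C : Set} {R : A → B → Set} {f : A → C} {g : B → C} →
  (∀ {x y} → R x y → f x ≡ g y) → ∀ {mx my} → Pointwise R mx my → Maybe.map f mx ≡ Maybe.map g my
map-cong-Pointwise f≡g (just r) = cong just (f≡g r)
map-cong-Pointwise f≡g nothing = refl

-- Inversions

𝟙[_<_] : Fin n → Fin n → ℕ
𝟙[ y < x ] = if toℕ y <ᵇ toℕ x then 1 else 0

countLess : Fin n → Vec (Fin n) k → ℕ
countLess x v = sum (tabulate λ b → 𝟙[ lookup v b < x ])

-- Defs' `inv` for vectors of any length, so `inv w` is definitionally `inversions w`;
-- `inversions (x ∷ v)` unfolds to `countLess x v + inversions v`.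
inversions : Vec (Fin n) k → ℕ
inversions w = sum (tabulate λ a → sum (tabulate λ b →
  if (toℕ a <ᵇ toℕ b) ∧ (toℕ (lookup w b) <ᵇ toℕ (lookup w a)) then 1 else 0))

𝟙[<]-≡1 : {x y : Fin n} → y < x → 𝟙[ y < x ] ≡ 1
𝟙[<]-≡1 {x = x} {y} y<x rewrite dec-true (toℕ y ℕ.<? toℕ x) y<x = refl

𝟙[<]-≡0 : {x y : Fin n} → ¬ y < x → 𝟙[ y < x ] ≡ 0
𝟙[<]-≡0 {x = x} {y} y≮x rewrite dec-false (toℕ y ℕ.<? toℕ x) y≮x = refl

𝟙[<]-monoʳ : (y : Fin n) {a b : Fin n} → a < b → 𝟙[ y < a ] ℕ.≤ 𝟙[ y < b ]
𝟙[<]-monoʳ y {a} {b} a<b with toℕ y ℕ.<? toℕ a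
... | yes y<a rewrite 𝟙[<]-≡1 y<a | 𝟙[<]-≡1 {x = b} (ℕ.<-trans y<a a<b) = ≤-refl
... | no y≮a rewrite 𝟙[<]-≡0 y≮a = z≤n

𝟙[<]-antitoneˡ : (x : Fin n) {a b : Fin n} → a < b → 𝟙[ b < x ] ℕ.≤ 𝟙[ a < x ]
𝟙[<]-antitoneˡ x {a} {b} a<b with toℕ b ℕ.<? toℕ x
... | yes b<x rewrite 𝟙[<]-≡1 b<x | 𝟙[<]-≡1 {x = x} (ℕ.<-trans a<b b<x) = ≤-refl
... | no b≮x rewrite 𝟙[<]-≡0 b≮x = z≤n

place : {A : Set} → Vec A k → Fin k → Fin k → A → A → Vec A k
place v i j a b = (v [ i ]≔ a) [ j ]≔ b

place-lookup : {A : Set} (v : Vec A k) (i j : Fin k) → place v i j (lookup v i) (lookup v j) ≡ v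
place-lookup v i j = trans (cong (_[ j ]≔ lookup v j) ([]≔-lookup v i)) ([]≔-lookup v j)

countLess-transpose-head : ∀ x a b (v : Vec (Fin n) k) j →
  countLess x (a ∷ v [ j ]≔ b) ≡ countLess x (b ∷ v [ j ]≔ a)
countLess-transpose-head x a b (y ∷ v) zero = x∙yz≈y∙xz 𝟙[ a < x ] 𝟙[ b < x ] (countLess x v)
countLess-transpose-head x a b (y ∷ v) (suc j) = begin
  𝟙[ a < x ] + (𝟙[ y < x ] + countLess x (v [ j ]≔ b))
    ≡⟨ x∙yz≈y∙xz 𝟙[ a < x ] 𝟙[ y < x ] _ ⟩
  𝟙[ y < x ] + (𝟙[ a < x ] + countLess x (v [ j ]≔ b))
    ≡⟨ cong (𝟙[ y < x ] +_) (countLess-transpose-head x a b v j) ⟩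
  𝟙[ y < x ] + (𝟙[ b < x ] + countLess x (v [ j ]≔ a))
    ≡⟨ x∙yz≈y∙xz 𝟙[ y < x ] 𝟙[ b < x ] _ ⟩
  𝟙[ b < x ] + (𝟙[ y < x ] + countLess x (v [ j ]≔ a)) ∎
  where open ≡-Reasoning

countLess-place-swap : ∀ x (v : Vec (Fin n) k) {i j} → i < j → ∀ a b →
  countLess x (place v i j a b) ≡ countLess x (place v i j b a)
countLess-place-swap x (y ∷ v) {zero} {suc j} _ a b = countLess-transpose-head x a b v j
countLess-place-swap x (y ∷ v) {suc i} {suc j} (s≤s i<j) a b =
  cong (𝟙[ y < x ] +_) (countLess-place-swap x v i<j a b)

countLess-update-antitone : ∀ x (v : Vec (Fin n) k) j {a b} → a < b →
  countLess x (v [ j ]≔ b) ℕ.≤ countLess x (v [ j ]≔ a)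
countLess-update-antitone x (y ∷ v) zero a<b = ℕ.+-monoˡ-≤ (countLess x v) (𝟙[<]-antitoneˡ x a<b)
countLess-update-antitone x (y ∷ v) (suc j) a<b =
  +-monoʳ-≤ 𝟙[ y < x ] (countLess-update-antitone x v j a<b)

inversions-∷∷ : ∀ a y (u : Vec (Fin n) k) →
  inversions (a ∷ y ∷ u) ≡ (𝟙[ y < a ] + countLess y u) + inversions (a ∷ u)
inversions-∷∷ a y u = interchange 𝟙[ y < a ] (countLess a u) (countLess y u) (inversions u)

inversions-transpose-head : ∀ (v : Vec (Fin n) k) j {a b} → a < b →
  inversions (a ∷ v [ j ]≔ b) ℕ.< inversions (b ∷ v [ j ]≔ a)
inversions-transpose-head (y ∷ v) zero {a} {b} a<b
  rewrite 𝟙[<]-≡0 (ℕ.<⇒≯ a<b) | 𝟙[<]-≡1 a<b =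
  s≤s (≤-reflexive (x∙yz≈y∙xz (countLess a v) (countLess b v) (inversions v)))
inversions-transpose-head (y ∷ v) (suc j) {a} {b} a<b = begin-strict
  inversions (a ∷ y ∷ v [ j ]≔ b)
    ≡⟨ inversions-∷∷ a y (v [ j ]≔ b) ⟩
  (𝟙[ y < a ] + countLess y (v [ j ]≔ b)) + inversions (a ∷ v [ j ]≔ b)
    <⟨ +-mono-≤-< (+-mono-≤ (𝟙[<]-monoʳ y a<b) (countLess-update-antitone y v j a<b))
                  (inversions-transpose-head v j a<b) ⟩
  (𝟙[ y < b ] + countLess y (v [ j ]≔ a)) + inversions (b ∷ v [ j ]≔ a)
    ≡⟨ inversions-∷∷ b y (v [ j ]≔ a) ⟨
  inversions (b ∷ y ∷ v [ j ]≔ a)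
    ∎
  where open ℕ.≤-Reasoning

inversions-place : ∀ (v : Vec (Fin n) k) {i j} → i < j → ∀ {a b} → a < b →
  inversions (place v i j a b) ℕ.< inversions (place v i j b a)
inversions-place (y ∷ v) {zero} {suc j} _ a<b = inversions-transpose-head v j a<b
inversions-place (y ∷ v) {suc i} {suc j} (s≤s i<j) {a} {b} a<b
  rewrite countLess-place-swap y v i<j a b = +-monoʳ-< _ (inversions-place v i<j a<b)

inversions-swap-< : ∀ (v : OneLine n) {i j} → i < j → lookup v i < lookup v j →
  inversions v ℕ.< inversions (swap v i j)
inversions-swap-< v {i} {j} i<j vi<vj =
  subst (λ u → inversions u ℕ.< inversions (swap v i j)) (place-lookup v i j)
        (inversions-place v i<j vi<vj)

inversions-swap-> : ∀ (v : OneLine n) {i j} → i < j → lookup v j < lookup v i →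
  inversions (swap v i j) ℕ.< inversions v
inversions-swap-> v {i} {j} i<j vj<vi =
  subst (λ u → inversions (swap v i j) ℕ.< inversions u) (place-lookup v i j)
        (inversions-place v i<j vj<vi)

-- The cyclic shift

Below : ∀ {m} → Fin (suc m) → Set
Below {m} y = toℕ y ℕ.< m

toℕ-cyc : ∀ {m} {y : Fin (suc m)} → Below y → toℕ (cyc y) ≡ suc (toℕ y)
toℕ-cyc {m} {y} y<m with toℕ y ℕ.<? m
... | yes p = cong suc (Fin.toℕ-fromℕ< p)
... | no y≮m = contradiction y<m y≮m

cyc-fromℕ : ∀ m → cyc (fromℕ m) ≡ zero
cyc-fromℕ m with toℕ (fromℕ m) ℕ.<? m
... | yes p = contradiction (subst (ℕ._< m) (Fin.toℕ-fromℕ m) p) (ℕ.<-irrefl refl)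
... | no _ = refl

Below-fromℕ : ∀ {m} {y : Fin (suc m)} → Below y → y < fromℕ m
Below-fromℕ {m} {y} y<m = subst (toℕ y ℕ.<_) (sym (Fin.toℕ-fromℕ m)) y<m

cyc-fromℕ-< : ∀ {m} {x : Fin (suc m)} → Below x → cyc (fromℕ m) < cyc x
cyc-fromℕ-< {m} x<m = subst₂ ℕ._<_ (cong toℕ (sym (cyc-fromℕ m))) (sym (toℕ-cyc x<m)) (s≤s z≤n)

𝟙[<]-cyc : ∀ {m} {x y : Fin (suc m)} → Below x → Below y → 𝟙[ cyc y < cyc x ] ≡ 𝟙[ y < x ]
𝟙[<]-cyc x<m y<m rewrite toℕ-cyc x<m | toℕ-cyc y<m = refl

countLess-zero : (v : Vec (Fin (suc n)) k) → countLess zero v ≡ 0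
countLess-zero [] = refl
countLess-zero (y ∷ v) = countLess-zero v

countLess-fromℕ : ∀ {m} {v : Vec (Fin (suc m)) k} → All Below v → countLess (fromℕ m) v ≡ k
countLess-fromℕ [] = refl
countLess-fromℕ (y<m ∷ v<m) = cong₂ _+_ (𝟙[<]-≡1 (Below-fromℕ y<m)) (countLess-fromℕ v<m)

countLess-map-cyc : ∀ {m} {x : Fin (suc m)} {v : Vec (Fin (suc m)) k} → Below x → All Below v →
  countLess (cyc x) (map cyc v) ≡ countLess x v
countLess-map-cyc x<m [] = refl
countLess-map-cyc x<m (y<m ∷ v<m) = cong₂ _+_ (𝟙[<]-cyc x<m y<m) (countLess-map-cyc x<m v<m)

inversions-map-cyc-Below : ∀ {m} {v : Vec (Fin (suc m)) k} → All Below v →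
  inversions (map cyc v) ≡ inversions v
inversions-map-cyc-Below [] = refl
inversions-map-cyc-Below (x<m ∷ v<m) =
  cong₂ _+_ (countLess-map-cyc x<m v<m) (inversions-map-cyc-Below v<m)

data TopAt {m} : Vec (Fin (suc m)) k → Fin k → Set where
  here  : {v : Vec (Fin (suc m)) k} → All Below v → TopAt (fromℕ m ∷ v) zero
  there : {x : Fin (suc m)} {v : Vec (Fin (suc m)) k} {t : Fin k} →
          Below x → TopAt v t → TopAt (x ∷ v) (suc t)

countLess-map-cyc-TopAt : ∀ {m} {x : Fin (suc m)} {v : Vec (Fin (suc m)) k} {t} →
  Below x → TopAt v t → countLess (cyc x) (map cyc v) ≡ suc (countLess x v)
countLess-map-cyc-TopAt {m = m} {x} x<m (here {v = v} v<m) =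
  trans (cong₂ _+_ (𝟙[<]-≡1 (cyc-fromℕ-< x<m)) (countLess-map-cyc x<m v<m))
        (cong (λ z → suc (z + countLess x v)) (sym (𝟙[<]-≡0 (ℕ.<⇒≯ (Below-fromℕ x<m)))))
countLess-map-cyc-TopAt x<m (there y<m top)
  rewrite 𝟙[<]-cyc x<m y<m | countLess-map-cyc-TopAt x<m top = +-suc _ _

inversions-map-cyc : ∀ {m} {v : Vec (Fin (suc m)) (suc k)} {t} → TopAt v t →
  inversions (map cyc v) + k ≡ inversions v + 2 * toℕ t
inversions-map-cyc {k = k} {m} (here {v = v} v<m) = begin
  (countLess (cyc (fromℕ m)) (map cyc v) + inversions (map cyc v)) + k
    ≡⟨ cong (λ z → (countLess z (map cyc v) + inversions (map cyc v)) + k) (cyc-fromℕ m) ⟩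
  (countLess zero (map cyc v) + inversions (map cyc v)) + k
    ≡⟨ cong₂ (λ a b → (a + b) + k) (countLess-zero (map cyc v)) (inversions-map-cyc-Below v<m) ⟩
  inversions v + k                             ≡⟨ +-comm (inversions v) k ⟩
  k + inversions v                             ≡⟨ cong (_+ inversions v) (countLess-fromℕ v<m) ⟨
  countLess (fromℕ m) v + inversions v         ≡⟨ +-identityʳ _ ⟨
  (countLess (fromℕ m) v + inversions v) + 0   ∎
  where open ≡-Reasoning
inversions-map-cyc {k = suc k} (there {x = x} {v} {t} x<m top)
  rewrite countLess-map-cyc-TopAt x<m top = begin
  (suc c + inversions (map cyc v)) + suc k ≡⟨ regroup c (inversions (map cyc v)) k ⟩
  2 + (c + (inversions (map cyc v) + k))  ≡⟨ cong (λ s → 2 + (c + s)) (inversions-map-cyc top) ⟩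
  2 + (c + (inversions v + 2 * toℕ t))   ≡⟨ ungroup c (inversions v) (toℕ t) ⟩
  (c + inversions v) + 2 * suc (toℕ t)   ∎
  where
  open ≡-Reasoning
  c : ℕ
  c = countLess x v
  regroup : ∀ c i k → (suc c + i) + suc k ≡ 2 + (c + (i + k))
  regroup = solve-∀
  ungroup : ∀ c i t → 2 + (c + (i + 2 * t)) ≡ (c + i) + 2 * suc t
  ungroup = solve-∀

posOf-TopAt : ∀ {m} {v : Vec (Fin (suc m)) k} {t} → TopAt v t → posOf (fromℕ m) v ≡ toℕ t
posOf-TopAt {m = m} (here _) rewrite dec-true (toℕ (fromℕ m) ℕ.≟ toℕ (fromℕ m)) refl = refl
posOf-TopAt {m = m} (there {x = x} x<m top)
  rewrite dec-false (toℕ (fromℕ m) ℕ.≟ toℕ x) (λ eq → ℕ.<-irrefl (sym eq) (Below-fromℕ x<m))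
        | posOf-TopAt top = refl

map-swap : (f : Fin n → Fin n) (v : OneLine n) (i j : Fin n) → map f (swap v i j) ≡ swap (map f v) i j
map-swap f v i j = begin
  map f ((v [ i ]≔ lookup v j) [ j ]≔ lookup v i)        ≡⟨ map-[]≔ f (v [ i ]≔ lookup v j) j ⟩
  map f (v [ i ]≔ lookup v j) [ j ]≔ f (lookup v i)
    ≡⟨ cong (_[ j ]≔ f (lookup v i)) (map-[]≔ f v i) ⟩
  (map f v [ i ]≔ f (lookup v j)) [ j ]≔ f (lookup v i)
    ≡⟨ cong₂ (λ x y → (map f v [ i ]≔ x) [ j ]≔ y) (lookup-map j f v) (lookup-map i f v) ⟨
  swap (map f v) i j                                      ∎
  where open ≡-Reasoning

swap-top-rightwards : ∀ {m} (v : OneLine (suc m)) {i j} → i < j →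
  lookup v i ≡ fromℕ m → Below (lookup v j) →
  inversions (swap v i j) ℕ.< inversions v × inversions (map cyc v) ℕ.< inversions (map cyc (swap v i j))
swap-top-rightwards v {i} {j} i<j vi≡top vj<m =
  inversions-swap-> v i<j vj<vi ,
  subst (λ u → inversions (map cyc v) ℕ.< inversions u) (sym (map-swap cyc v i j))
        (inversions-swap-< (map cyc v) i<j cycvi<cycvj)
  where
  vj<vi : lookup v j < lookup v i
  vj<vi = subst (lookup v j <_) (sym vi≡top) (Below-fromℕ vj<m)
  cycvi<cycvj : lookup (map cyc v) i < lookup (map cyc v) j
  cycvi<cycvj = subst₂ _<_ (sym (trans (lookup-map i cyc v) (cong cyc vi≡top))) (sym (lookup-map j cyc v))
                           (cyc-fromℕ-< vj<m)

swap-top-leftwards : ∀ {m} (v : OneLine (suc m)) {i j} → i < j →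
  lookup v j ≡ fromℕ m → Below (lookup v i) →
  inversions v ℕ.< inversions (swap v i j) × inversions (map cyc (swap v i j)) ℕ.< inversions (map cyc v)
swap-top-leftwards v {i} {j} i<j vj≡top vi<m =
  inversions-swap-< v i<j vi<vj ,
  subst (λ u → inversions u ℕ.< inversions (map cyc v)) (sym (map-swap cyc v i j))
        (inversions-swap-> (map cyc v) i<j cycvj<cycvi)
  where
  vi<vj : lookup v i < lookup v j
  vi<vj = subst (lookup v i <_) (sym vj≡top) (Below-fromℕ vi<m)
  cycvj<cycvi : lookup (map cyc v) j < lookup (map cyc v) i
  cycvj<cycvi = subst₂ _<_ (sym (trans (lookup-map j cyc v) (cong cyc vj≡top))) (sym (lookup-map i cyc v))
                           (cyc-fromℕ-< vi<m)

Below-≢ : ∀ {m} {y : Fin (suc m)} → y ≢ fromℕ m → Below y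
Below-≢ {m} {y} y≢top = ℕ.≤∧≢⇒< (ℕ.s≤s⁻¹ (Fin.toℕ<n y))
  (λ eq → y≢top (Fin.toℕ-injective (trans eq (sym (Fin.toℕ-fromℕ m)))))

TopAt-lookup : ∀ {m} (v : Vec (Fin (suc m)) k) t → lookup v t ≡ fromℕ m →
  (∀ s → s ≢ t → lookup v s ≢ fromℕ m) → TopAt v t
TopAt-lookup (x ∷ v) zero refl others = here (lookup⁻ λ s → Below-≢ (others (suc s) λ ()))
TopAt-lookup (x ∷ v) (suc t) at others =
  there (Below-≢ (others zero λ ()))
        (TopAt-lookup v t at λ s s≢t → others (suc s) (s≢t ∘ Fin.suc-injective))

oneLine-at-inverse : (π : Permutation′ n) (x : Fin n) → lookup (oneLine π) (π ⟨$⟩ˡ x) ≡ x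
oneLine-at-inverse π x = trans (lookup∘tabulate (π ⟨$⟩ʳ_) (π ⟨$⟩ˡ x)) (inverseʳ π)

oneLine-elsewhere : (π : Permutation′ n) {x s : Fin n} → s ≢ π ⟨$⟩ˡ x → lookup (oneLine π) s ≢ x
oneLine-elsewhere π {x} {s} s≢ eq =
  s≢ (trans (sym (inverseˡ π)) (cong (π ⟨$⟩ˡ_) (trans (sym (lookup∘tabulate (π ⟨$⟩ʳ_) s)) eq)))

oneLine-TopAt : ∀ {m} (π : Permutation′ (suc m)) → TopAt (oneLine π) (π ⟨$⟩ˡ fromℕ m)
oneLine-TopAt π = TopAt-lookup (oneLine π) _ (oneLine-at-inverse π _) (λ s → oneLine-elsewhere π)

lookup-swap : (v : OneLine n) {i j : Fin n} → i ≢ j →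
  ∀ s → lookup (swap v i j) s ≡ lookup v (PC.transpose i j s)
lookup-swap v {i} {j} i≢j s with s Fin.≟ i | s Fin.≟ j
... | yes refl | _ =
  trans (lookup∘update′ i≢j (v [ s ]≔ lookup v j) (lookup v s)) (lookup∘update s v (lookup v j))
... | no _ | yes refl rewrite dec-true (s Fin.≟ s) refl =
  lookup∘update s (v [ i ]≔ lookup v s) (lookup v i)
... | no s≢i | no s≢j rewrite dec-false (s Fin.≟ j) s≢j =
  trans (lookup∘update′ s≢j (v [ i ]≔ lookup v j) (lookup v i)) (lookup∘update′ s≢i v (lookup v j))

swap-oneLine : (π : Permutation′ n) {i j : Fin n} → i ≢ j →
  swap (oneLine π) i j ≡ oneLine (transpose i j ∘ₚ π)
swap-oneLine π {i} {j} i≢j = begin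
  swap (oneLine π) i j                                      ≡⟨ tabulate∘lookup _ ⟨
  tabulate (lookup (swap (oneLine π) i j))                  ≡⟨ tabulate-cong (lookup-swap (oneLine π) i≢j) ⟩
  tabulate (λ s → lookup (oneLine π) (PC.transpose i j s))
    ≡⟨ tabulate-cong (λ s → lookup∘tabulate (π ⟨$⟩ʳ_) (PC.transpose i j s)) ⟩
  oneLine (transpose i j ∘ₚ π)                              ∎
  where open ≡-Reasoning

transpose-≢ : {i j k : Fin n} → k ≢ i → k ≢ j → PC.transpose i j k ≡ k
transpose-≢ {i = i} {j} {k} k≢i k≢j
  rewrite dec-false (k Fin.≟ i) k≢i | dec-false (k Fin.≟ j) k≢j = refl

transpose-left : (i j : Fin n) → PC.transpose i j i ≡ j
transpose-left i j rewrite dec-true (i Fin.≟ i) refl = refl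

transpose-right : {i j : Fin n} → j ≢ i → PC.transpose i j j ≡ i
transpose-right {i = i} {j} j≢i rewrite dec-false (j Fin.≟ i) j≢i | dec-true (j Fin.≟ j) refl = refl

-- Monomials

_⊕_ : Mono n → Mono n → Mono n
_⊕_ = zipWith _+_

⊕-assoc : (x y z : Mono n) → (x ⊕ y) ⊕ z ≡ x ⊕ (y ⊕ z)
⊕-assoc = zipWith-assoc +-assoc

⊕-comm : (x y : Mono n) → x ⊕ y ≡ y ⊕ x
⊕-comm = zipWith-comm +-comm

⊕-identityʳ : (x : Mono n) → x ⊕ zeroMono ≡ x
⊕-identityʳ = zipWith-identityʳ +-identityʳ

⊕-identityˡ : (x : Mono n) → zeroMono ⊕ x ≡ x
⊕-identityˡ = zipWith-identityˡ (λ _ → refl)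

⊕-tabulate : (f g : Fin n → ℕ) → tabulate f ⊕ tabulate g ≡ tabulate (λ k → f k + g k)
⊕-tabulate {zero} f g = refl
⊕-tabulate {suc n} f g = cong (f zero + g zero ∷_) (⊕-tabulate (f ∘ suc) (g ∘ suc))

-- `qInterval a b` is `tabulate λ k → 𝟙[ a ≤ toℕ k < b ]`.
𝟙[_≤_<_] : ℕ → ℕ → ℕ → ℕ
𝟙[ a ≤ x < b ] = if (a ≤ᵇ x) ∧ (x <ᵇ b) then 1 else 0

𝟙[≤<]-split : ∀ {a b c} → a ℕ.≤ b → b ℕ.≤ c →
  ∀ x → 𝟙[ a ≤ x < b ] + 𝟙[ b ≤ x < c ] ≡ 𝟙[ a ≤ x < c ]
𝟙[≤<]-split {a} {b} {c} a≤b b≤c x with a ℕ.≤? x | x ℕ.<? b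
... | no a≰x | _
  rewrite dec-false (a ℕ.≤? x) a≰x | dec-false (b ℕ.≤? x) (a≰x ∘ ℕ.≤-trans a≤b) = refl
... | yes a≤x | yes x<b
  rewrite dec-true (a ℕ.≤? x) a≤x | dec-true (x ℕ.<? b) x<b | dec-false (b ℕ.≤? x) (ℕ.<⇒≱ x<b)
        | dec-true (x ℕ.<? c) (ℕ.<-≤-trans x<b b≤c) = refl
... | yes a≤x | no x≮b
  rewrite dec-true (a ℕ.≤? x) a≤x | dec-false (x ℕ.<? b) x≮b | dec-true (b ℕ.≤? x) (ℕ.≮⇒≥ x≮b)
  = refl

qInterval-split : ∀ {a b c} → a ℕ.≤ b → b ℕ.≤ c →
  qInterval {n} a b ⊕ qInterval b c ≡ qInterval a c
qInterval-split a≤b b≤c =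
  trans (⊕-tabulate _ _) (tabulate-cong λ k → 𝟙[≤<]-split a≤b b≤c (toℕ k))

+1-transfer : ∀ {U V A B} → V + A ≡ B + U → V ≡ U + 1 → B ≡ A + 1
+1-transfer {U} {V} {A} {B} balance V≡U+1 = ℕ.+-cancelʳ-≡ U B (A + 1) (begin
  B + U        ≡⟨ balance ⟨
  V + A        ≡⟨ cong (_+ A) V≡U+1 ⟩
  (U + 1) + A  ≡⟨ xy∙z≈zy∙x U 1 A ⟩
  (A + 1) + U  ∎)
  where open ≡-Reasoning

+1-transfer-⇔ : ∀ {U V A B} → V + A ≡ B + U → (V ≡ U + 1 ⇔ B ≡ A + 1)
+1-transfer-⇔ balance = mk⇔ (+1-transfer balance) (+1-transfer (sym balance))

balance-+ : ∀ {U V A B} c → V + A ≡ B + U → (V + c) + A ≡ (B + c) + U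
balance-+ {U} {V} {A} {B} c balance =
  trans (xy∙z≈xz∙y V c A) (trans (cong (_+ c) balance) (xy∙z≈xz∙y B U c))

<⇒+≢+1 : ∀ {U V c} → U ℕ.< V → 0 ℕ.< c → V + c ≢ U + 1
<⇒+≢+1 {U} {V} {c} U<V 0<c eq = ℕ.<-irrefl (sym eq) (begin-strict
  U + 1  ≡⟨ +-comm U 1 ⟩
  suc U  ≤⟨ U<V ⟩
  V      <⟨ ℕ.m<m+n V 0<c ⟩
  V + c  ∎)
  where open ℕ.≤-Reasoning

cyc-balance : ∀ {U V A B m p} → U + m ≡ A + 2 * p → V + m ≡ B + 2 * p → V + A ≡ B + U
cyc-balance {U} {V} {A} {B} {m} {p} cycU cycV = ℕ.+-cancelʳ-≡ m (V + A) (B + U) (begin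
  (V + A) + m        ≡⟨ xy∙z≈xz∙y V A m ⟩
  (V + m) + A        ≡⟨ cong (_+ A) cycV ⟩
  (B + 2 * p) + A    ≡⟨ xy∙z≈zy∙x B (2 * p) A ⟩
  (A + 2 * p) + B    ≡⟨ cong (_+ B) cycU ⟨
  (U + m) + B        ≡⟨ xy∙z≈zx∙y U m B ⟩
  (B + U) + m        ∎)
  where open ≡-Reasoning

cyc-gap : ∀ {U V A B m i j} → i ℕ.≤ j → U + m ≡ A + 2 * i → V + m ≡ B + 2 * j →
  V + A ≡ (B + 2 * (j ∸ i)) + U
cyc-gap {U} {V} {A} {B} {m} {i} {j} i≤j cycU cycV =
  ℕ.+-cancelʳ-≡ (m + 2 * i) (V + A) (B + 2 * d + U) (begin
  (V + A) + (m + 2 * i)            ≡⟨ interchange V A m (2 * i) ⟩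
  (V + m) + (A + 2 * i)            ≡⟨ cong₂ _+_ cycV (sym cycU) ⟩
  (B + 2 * j) + (U + m)            ≡⟨ cong (λ k → (B + 2 * k) + (U + m)) (ℕ.m+[n∸m]≡n i≤j) ⟨
  (B + 2 * (i + d)) + (U + m)      ≡⟨ regroup B i d U m ⟩
  (B + 2 * d + U) + (m + 2 * i)    ∎)
  where
  open ≡-Reasoning
  d : ℕ
  d = j ∸ i
  regroup : ∀ B i d U m → (B + 2 * (i + d)) + (U + m) ≡ (B + 2 * d + U) + (m + 2 * i)
  regroup = solve-∀

data Branch : Set where
  classical quantum : Branch

branch : ℕ → ℕ → ℕ → Maybe Branch
branch ℓw ℓws d =
  if ℓws ≡ᵇ ℓw + 1 then just classical
  else if ℓws + 2 * d ≡ᵇ ℓw + 1 then just quantum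
  else nothing

weight : Mono n → Branch → Mono n
weight q classical = zeroMono
weight q quantum = q

T-branch : (i j : Fin n) (v : OneLine n) →
  T i j v ≡ Maybe.map (λ b → weight (qInterval (toℕ i) (toℕ j)) b , swap v i j)
                      (branch (inv v) (inv (swap v i j)) (toℕ j ∸ toℕ i))
T-branch i j v with inv (swap v i j) ≡ᵇ inv v + 1
... | true = refl
... | false with inv (swap v i j) + 2 * (toℕ j ∸ toℕ i) ≡ᵇ inv v + 1
...   | true = refl
...   | false = refl

ext-T : (i j : Fin n) (e : Mono n) (v : OneLine n) →
  ext (T i j) (just (e , v)) ≡
    Maybe.map (λ b → e ⊕ weight (qInterval (toℕ i) (toℕ j)) b , swap v i j)
              (branch (inv v) (inv (swap v i j)) (toℕ j ∸ toℕ i))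
ext-T i j e v rewrite T-branch i j v with branch (inv v) (inv (swap v i j)) (toℕ j ∸ toℕ i)
... | just _ = refl
... | nothing = refl

ext-O-map : ∀ {m} {A : Set} (f : A → Mono (suc m)) (u : OneLine (suc m)) (mb : Maybe A) →
  ext O (Maybe.map (λ b → f b , u) mb) ≡
    Maybe.map (λ b → f b ⊕ qInterval (posOf (fromℕ m) u) m , map cyc u) mb
ext-O-map f u (just _) = refl
ext-O-map f u nothing = refl

branch-cong : ∀ {U V A B} d → V + A ≡ B + U → branch U V d ≡ branch A B d
branch-cong {U} {V} {A} {B} d balance
  rewrite does-⇔ (+1-transfer-⇔ balance) (V ℕ.≟ U + 1) (B ℕ.≟ A + 1)
        | does-⇔ (+1-transfer-⇔ (balance-+ {U} {V} {A} {B} (2 * d) balance))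
                 (V + 2 * d ℕ.≟ U + 1) (B + 2 * d ℕ.≟ A + 1)
        = refl

branch-shift : ∀ {U V A B d} → U ℕ.< V → B ℕ.< A → 0 ℕ.< d → V + A ≡ (B + 2 * d) + U →
  Pointwise (λ bL bR → bL ≡ classical × bR ≡ quantum) (branch U V d) (branch A B d)
branch-shift {U} {V} {A} {B} {d} U<V B<A 0<d balance
  rewrite does-⇔ (+1-transfer-⇔ balance) (V ℕ.≟ U + 1) (B + 2 * d ℕ.≟ A + 1)
        | dec-false (B ℕ.≟ A + 1) (ℕ.<⇒≢ (ℕ.<-trans B<A (ℕ.m<m+n A ℕ.z<s)))
        | dec-false (V + 2 * d ℕ.≟ U + 1) (<⇒+≢+1 U<V (ℕ.*-monoʳ-< 2 0<d))
  with B + 2 * d ≡ᵇ A + 1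
... | true = just (refl , refl)
... | false = nothing

-- O attaches `qInterval p m` when the top value sits at position p, so this says that
-- T_ij ∘ O and O ∘ T_ij attach the same monomial.
MonomialsAgree : Mono n → ℕ → ℕ → ℕ → Branch → Branch → Set
MonomialsAgree q m p₀ p₁ bL bR = qInterval p₀ m ⊕ weight q bL ≡ weight q bR ⊕ qInterval p₁ m

agree-away : ∀ (q : Mono n) {U V A B m p₀ p₁ d} → p₁ ≡ p₀ →
  U + m ≡ A + 2 * p₀ → V + m ≡ B + 2 * p₁ →
  Pointwise (MonomialsAgree q m p₀ p₁) (branch U V d) (branch A B d)
agree-away q {U} {V} {A} {B} {m} {p} {d = d} refl cycU cycV =
  Pointwise.reflexive (λ { {b} refl → ⊕-comm _ (weight q b) })
    (branch-cong {U} {V} {A} {B} d (cyc-balance {U} {V} {A} {B} {m} {p} cycU cycV))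

agree-left : ∀ {U V A B m i j p₀ p₁} → p₀ ≡ i → p₁ ≡ j → i ℕ.< j → j ℕ.≤ m →
  U ℕ.< V → B ℕ.< A → U + m ≡ A + 2 * p₀ → V + m ≡ B + 2 * p₁ →
  Pointwise (MonomialsAgree {n} (qInterval i j) m p₀ p₁) (branch U V (j ∸ i)) (branch A B (j ∸ i))
agree-left {U = U} {V} {A} {B} refl refl i<j j≤m U<V B<A cycU cycV =
  Pointwise-map (λ { (refl , refl) → trans (⊕-identityʳ _) (sym (qInterval-split (ℕ.<⇒≤ i<j) j≤m)) })
    (branch-shift U<V B<A (ℕ.m<n⇒0<n∸m i<j) (cyc-gap {U} {V} {A} {B} (ℕ.<⇒≤ i<j) cycU cycV))

agree-right : ∀ {U V A B m i j p₀ p₁} → p₀ ≡ j → p₁ ≡ i → i ℕ.< j → j ℕ.≤ m →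
  V ℕ.< U → A ℕ.< B → U + m ≡ A + 2 * p₀ → V + m ≡ B + 2 * p₁ →
  Pointwise (MonomialsAgree {n} (qInterval i j) m p₀ p₁) (branch U V (j ∸ i)) (branch A B (j ∸ i))
agree-right {U = U} {V} {A} {B} {i = i} {j} refl refl i<j j≤m V<U A<B cycU cycV =
  -- the top value at j is the top value at i with the two sides exchanged
  Pointwise-map
    (λ { (refl , refl) → trans (⊕-comm _ _) (trans (qInterval-split (ℕ.<⇒≤ i<j) j≤m) (sym (⊕-identityˡ _))) })
    (Pointwise.sym (λ (bR≡quantum , bL≡classical) → bL≡classical , bR≡quantum)
      (branch-shift {A} {B} {U} {V} A<B V<U (ℕ.m<n⇒0<n∸m i<j) balance))
  where
  balance : B + U ≡ (V + 2 * (j ∸ i)) + A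
  balance = trans (+-comm B U)
    (trans (cyc-gap {V} {U} {B} {A} (ℕ.<⇒≤ i<j) cycV cycU) (xy∙z≈zy∙x A (2 * (j ∸ i)) V))

-- Commutation

module Commutation {m : ℕ} {i j : Fin (suc m)} (i<j : i < j) (w : Permutation′ (suc m)) where

  v vs : OneLine (suc m)
  v = oneLine w
  vs = swap v i j

  t₀ t₁ : Fin (suc m)
  t₀ = w ⟨$⟩ˡ fromℕ m
  t₁ = (transpose i j ∘ₚ w) ⟨$⟩ˡ fromℕ m

  ℓv ℓvs ℓov ℓovs d : ℕ
  ℓv = inversions v
  ℓvs = inversions vs
  ℓov = inversions (map cyc v)
  ℓovs = inversions (map cyc vs)
  d = toℕ j ∸ toℕ i

  q : Mono (suc m)
  q = qInterval (toℕ i) (toℕ j)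

  i≢j : i ≢ j
  i≢j = ℕ.<⇒≢ i<j ∘ cong toℕ

  j≤m : toℕ j ℕ.≤ m
  j≤m = ℕ.s≤s⁻¹ (Fin.toℕ<n j)

  TopAt-vs : TopAt vs t₁
  TopAt-vs = subst (λ u → TopAt u t₁) (sym (swap-oneLine w i≢j)) (oneLine-TopAt (transpose i j ∘ₚ w))

  below : ∀ {s} → s ≢ t₀ → Below (lookup v s)
  below s≢t₀ = Below-≢ (oneLine-elsewhere w s≢t₀)

  top-at : ∀ {s} → t₀ ≡ s → lookup v s ≡ fromℕ m
  top-at refl = oneLine-at-inverse w (fromℕ m)

  Agreement : Set
  Agreement = Pointwise (MonomialsAgree q m (toℕ t₀) (toℕ t₁)) (branch ℓov ℓovs d) (branch ℓv ℓvs d)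

  agreement-by-position : Dec (t₀ ≡ i) → Dec (t₀ ≡ j) → Agreement
  agreement-by-position (yes t₀≡i) _ =
    agree-left (cong toℕ t₀≡i) (cong toℕ t₁≡j) i<j j≤m (proj₂ signs) (proj₁ signs)
      (inversions-map-cyc (oneLine-TopAt w)) (inversions-map-cyc TopAt-vs)
    where
    t₁≡j : t₁ ≡ j
    t₁≡j = trans (cong (PC.transpose j i) t₀≡i) (transpose-right i≢j)
    signs : ℓvs ℕ.< ℓv × ℓov ℕ.< ℓovs
    signs = swap-top-rightwards v i<j (top-at t₀≡i) (below (λ j≡t₀ → i≢j (trans (sym t₀≡i) (sym j≡t₀))))
  agreement-by-position (no t₀≢i) (yes t₀≡j) =
    agree-right (cong toℕ t₀≡j) (cong toℕ t₁≡i) i<j j≤m (proj₂ signs) (proj₁ signs)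
      (inversions-map-cyc (oneLine-TopAt w)) (inversions-map-cyc TopAt-vs)
    where
    t₁≡i : t₁ ≡ i
    t₁≡i = trans (cong (PC.transpose j i) t₀≡j) (transpose-left j i)
    signs : ℓv ℕ.< ℓvs × ℓovs ℕ.< ℓov
    signs = swap-top-leftwards v i<j (top-at t₀≡j) (below (t₀≢i ∘ sym))
  agreement-by-position (no t₀≢i) (no t₀≢j) =
    agree-away q {ℓov} {ℓovs} {ℓv} {ℓvs} {m} {d = d} (cong toℕ (transpose-≢ t₀≢j t₀≢i))
      (inversions-map-cyc (oneLine-TopAt w)) (inversions-map-cyc TopAt-vs)

  branches-agree : Agreement
  branches-agree = agreement-by-position (t₀ Fin.≟ i) (t₀ Fin.≟ j)

  T-after-O : ∀ e → ext (T i j) (ext O (basis e w)) ≡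
    Maybe.map (λ b → (e ⊕ qInterval (toℕ t₀) m) ⊕ weight q b , map cyc vs) (branch ℓov ℓovs d)
  T-after-O e = trans (ext-T i j _ (map cyc v))
    (cong₂ (λ p u → Maybe.map (λ b → (e ⊕ qInterval p m) ⊕ weight q b , u) (branch ℓov (inversions u) d))
           (posOf-TopAt (oneLine-TopAt w)) (sym (map-swap cyc v i j)))

  O-after-T : ∀ e → ext O (ext (T i j) (basis e w)) ≡
    Maybe.map (λ b → (e ⊕ weight q b) ⊕ qInterval (toℕ t₁) m , map cyc vs) (branch ℓv ℓvs d)
  O-after-T e rewrite ext-T i j e v | ext-O-map (λ b → e ⊕ weight q b) vs (branch ℓv ℓvs d)
                    | posOf-TopAt TopAt-vs = refl

proposition4p1 : (m : ℕ) (i j : Fin (suc m)) → i < j →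
    (e : Mono (suc m)) (w : Permutation′ (suc m)) →
    ext (T i j) (ext O (basis e w)) ≡ ext O (ext (T i j) (basis e w))
proposition4p1 m i j i<j e w = begin
  ext (T i j) (ext O (basis e w))
    ≡⟨ T-after-O e ⟩
  Maybe.map (λ b → (e ⊕ qInterval (toℕ t₀) m) ⊕ weight q b , map cyc vs) (branch ℓov ℓovs d)
    ≡⟨ map-cong-Pointwise (λ agree → cong (_, map cyc vs) (regroup agree)) branches-agree ⟩
  Maybe.map (λ b → (e ⊕ weight q b) ⊕ qInterval (toℕ t₁) m , map cyc vs) (branch ℓv ℓvs d)
    ≡⟨ O-after-T e ⟨
  ext O (ext (T i j) (basis e w))
    ∎
  where
  open ≡-Reasoning
  open Commutation i<j w
  regroup : ∀ {x y z u} → x ⊕ y ≡ z ⊕ u → (e ⊕ x) ⊕ y ≡ (e ⊕ z) ⊕ u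
  regroup {x} {y} {z} {u} eq = trans (⊕-assoc e x y) (trans (cong (e ⊕_) eq) (sym (⊕-assoc e z u)))
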